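{- Let $f:\mathbb{N}_+\to\mathbb{N}_+$ be strictly increasing and let $b\ge 2$ be an integer. Let $x_{\min}=\min\{x\in\mathbb{N}_+ : \frac{f(x)-x}{b}\text{ is an integer}\}$. If $x_{\min}$ exists, then $\operatorname{GR}_b(y=x+b:y=f(x))=f(x_{\min})$; if $x_{\min}$ does not exist, then $\operatorname{GR}_b(y=x+b:y=f(x))$ does not exist.
   Context: All colorings are exact: an exact $b$-coloring of $[n]=\{1,\dots,n\}$ is a surjective map $[n]\to[b]$. A rainbow solution of $y=x+b$ in $[n]$ is a pair $x_0,x_0+b\in[n]$ of different colors. A monochromatic solution of $y=f(x)$ in $[n]$ is a pair $x_0,y_0\in[n]$ with $y_0=f(x_0)$ and $x_0,y_0$ of the same color. The Gallai--Rado number $\operatorname{GR}_k(\mathcal{E}_1:\mathcal{E}_2)$ is the minimum positive integer $N$, if it exists, such that for all $n\ge N$, every exact $k$-coloring of $[n]$ contains either a rainbow solution of $\mathcal{E}_1$ or a monochromatic solution of $\mathcal{E}_2$. -}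

module Defs where

open import Data.Nat using (ℕ; _+_; _≤_; _<_)
open import Data.Fin using (Fin)
open import Data.Integer as ℤ using (ℤ; +_)
open import Data.Integer.Divisibility using () renaming (_∣_ to _∣ℤ_)
open import Data.Product using (Σ; _×_; ∃)
open import Data.Sum using (_⊎_)
open import Relation.Nullary using (¬_)
open import Relation.Binary.PropositionalEquality using (_≡_; _≢_)

-- A map f : ℕ₊ → ℕ₊ is represented by f : ℕ → ℕ whose value at 0 is ignored.
-- f maps positive integers to positive integers.
PosValued : (ℕ → ℕ) → Set
PosValued f = ∀ x → 1 ≤ x → 1 ≤ f x

StrictlyIncreasing : (ℕ → ℕ) → Set
StrictlyIncreasing f = ∀ x y → 1 ≤ x → x < y → f x < f y

_∈[_] : ℕ → ℕ → Set
x ∈[ n ] = 1 ≤ x × x ≤ n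

-- A b-coloring c : ℕ → Fin b (only values on [n] matter) is exact on [n]
-- when its restriction to [n] is surjective onto Fin b.
ExactColoring : (b n : ℕ) → (ℕ → Fin b) → Set
ExactColoring b n c = ∀ (j : Fin b) → Σ ℕ λ i → i ∈[ n ] × c i ≡ j

RainbowShift : (b n : ℕ) → (ℕ → Fin b) → Set
RainbowShift b n c = Σ ℕ λ x₀ → x₀ ∈[ n ] × (x₀ + b) ∈[ n ] × c x₀ ≢ c (x₀ + b)

MonoSol : (b n : ℕ) → (ℕ → ℕ) → (ℕ → Fin b) → Set
MonoSol b n f c = Σ ℕ λ x₀ → x₀ ∈[ n ] × f x₀ ∈[ n ] × c x₀ ≡ c (f x₀)

GRProperty : (b : ℕ) → (ℕ → ℕ) → ℕ → Set
GRProperty b f N = ∀ n → N ≤ n → ∀ (c : ℕ → Fin b) →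
  ExactColoring b n c → RainbowShift b n c ⊎ MonoSol b n f c

IsGR : (b : ℕ) → (ℕ → ℕ) → ℕ → Set
IsGR b f N = 1 ≤ N × GRProperty b f N × (∀ M → 1 ≤ M → GRProperty b f M → N ≤ M)

GRExists : (b : ℕ) → (ℕ → ℕ) → Set
GRExists b f = Σ ℕ λ N → 1 ≤ N × GRProperty b f N

DivCond : (b : ℕ) → (ℕ → ℕ) → ℕ → Set
DivCond b f x = (+ b) ∣ℤ ((+ f x) ℤ.- (+ x))

IsXmin : (b : ℕ) → (ℕ → ℕ) → ℕ → Set
IsXmin b f x = 1 ≤ x × DivCond b f x × (∀ y → 1 ≤ y → DivCond b f y → x ≤ y)

-- Colouring [n] by residues mod b admits no rainbow solution of y = x + b, and its
-- monochromatic solutions of y = f(x) are exactly the x with b ∣ f(x) − x; hence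
-- no n below f(x_min) (and, without x_min, no n at all) works. Conversely, for
-- n ≥ f(x_min) = x_min + k b, a colouring without rainbow solutions is constant
-- along x_min, x_min + b, …, x_min + k b, so (x_min, f(x_min)) is monochromatic.
-- The argument only needs b ≥ 1.
module Submission where

open import Defs
open import Data.Nat using (ℕ; zero; suc; _+_; _*_; _∸_; _≤_; _<_; z≤n; s≤s; s≤s⁻¹; _%_; _/_; NonZero; >-nonZero)
open import Data.Nat.Properties
open import Data.Nat.DivMod using (_mod_; m%n<n; m≡m%n+[m/n]*n; [m+n]%n≡m%n; m<n⇒m%n≡m; n%n≡0)
open import Data.Nat.Divisibility using (_∣_; divides; _∣0)
open import Data.Integer as ℤ using (+_)
open import Data.Integer.Properties using (m-n≡m⊖n; ⊖-≥)
open import Data.Fin using (Fin; toℕ) renaming (zero to fzero; suc to fsuc)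
open import Data.Fin.Properties using (toℕ-injective; toℕ-fromℕ<; toℕ<n) renaming (_≟_ to _≟ᶠ_)
open import Data.Product using (_×_; _,_; Σ; ∃)
open import Data.Sum using (_⊎_; inj₁; inj₂)
open import Data.Empty using (⊥-elim)
open import Relation.Nullary using (¬_; yes; no)
open import Relation.Binary.PropositionalEquality

∣+m-+n∣≡m∸n : ∀ {m n} → n ≤ m → ℤ.∣ + m ℤ.- + n ∣ ≡ m ∸ n
∣+m-+n∣≡m∸n {m} {n} n≤m = cong ℤ.∣_∣ (trans (m-n≡m⊖n m n) (⊖-≥ n≤m))

divCond⇒∣∸ : ∀ {b f x} → x ≤ f x → DivCond b f x → b ∣ f x ∸ x
divCond⇒∣∸ {b} x≤fx = subst (b ∣_) (∣+m-+n∣≡m∸n x≤fx)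

∣∸⇒divCond : ∀ {b f x} → x ≤ f x → b ∣ f x ∸ x → DivCond b f x
∣∸⇒divCond {b} x≤fx = subst (b ∣_) (sym (∣+m-+n∣≡m∸n x≤fx))

∣∸⇒≡+* : ∀ {d m n} → m ≤ n → d ∣ n ∸ m → ∃ λ k → n ≡ m + k * d
∣∸⇒≡+* {m = m} m≤n (divides k n∸m≡k*d) = k , trans (sym (m+[n∸m]≡n m≤n)) (cong (_+_ m) n∸m≡k*d)

%≡%⇒∣∸ : ∀ {d m n} .{{_ : NonZero d}} → m % d ≡ n % d → d ∣ n ∸ m
%≡%⇒∣∸ {d} {m} {n} m%d≡n%d = divides (n / d ∸ m / d) (begin
  n ∸ m                                   ≡⟨ cong₂ _∸_ (m≡m%n+[m/n]*n n d) (m≡m%n+[m/n]*n m d) ⟩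
  (n % d + n / d * d) ∸ (m % d + m / d * d) ≡⟨ cong (λ r → (n % d + n / d * d) ∸ (r + m / d * d)) m%d≡n%d ⟩
  (n % d + n / d * d) ∸ (n % d + m / d * d) ≡⟨ [m+n]∸[m+o]≡n∸o (n % d) _ _ ⟩
  n / d * d ∸ m / d * d                     ≡⟨ *-distribʳ-∸ d (n / d) (m / d) ⟨
  (n / d ∸ m / d) * d                       ∎)
  where open ≡-Reasoning

monotone : ∀ {f} → StrictlyIncreasing f → ∀ {x y} → 1 ≤ x → x ≤ y → f x ≤ f y
monotone inc {x} {y} 1≤x x≤y with m≤n⇒m<n∨m≡n x≤y
... | inj₁ x<y  = <⇒≤ (inc x y 1≤x x<y)
... | inj₂ refl = ≤-refl

module _ {f : ℕ → ℕ} (pos : PosValued f) (inc : StrictlyIncreasing f) where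

  inflationary : ∀ {x} → 1 ≤ x → x ≤ f x
  inflationary {suc zero}    _ = pos 1 ≤-refl
  inflationary {suc (suc x)} _ = <-≤-trans (s≤s (inflationary (s≤s z≤n))) (inc (suc x) (suc (suc x)) (s≤s z≤n) ≤-refl)

  fixedPoint-pred : ∀ {x} → 1 ≤ x → f (suc x) ≡ suc x → f x ≡ x
  fixedPoint-pred {x} 1≤x f[1+x]≡1+x =
    ≤-antisym (s≤s⁻¹ (subst (f x <_) f[1+x]≡1+x (inc x (suc x) 1≤x ≤-refl))) (inflationary 1≤x)

  fixedPoint⇒divCond : ∀ {b x} → f x ≡ x → DivCond b f x
  fixedPoint⇒divCond {b} {x} fx≡x =
    ∣∸⇒divCond {f = f} (≤-reflexive (sym fx≡x)) (subst (b ∣_) (sym (trans (cong (_∸ x) fx≡x) (n∸n≡0 x))) (b ∣0))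

  xmin-fixedPoint⇒≡1 : ∀ {b xm} → IsXmin b f xm → f xm ≡ xm → xm ≡ 1
  xmin-fixedPoint⇒≡1 {xm = suc zero}    _ _ = refl
  xmin-fixedPoint⇒≡1 {xm = suc (suc x)} (_ , _ , least) fxm≡xm =
    ⊥-elim (1+n≰n (least (suc x) (s≤s z≤n) (fixedPoint⇒divCond (fixedPoint-pred (s≤s z≤n) fxm≡xm))))

module _ {b n : ℕ} (c : ℕ → Fin b) where

  rainbow⊎sameColour : ∀ {x} → 1 ≤ x → x + b ≤ n → RainbowShift b n c ⊎ c x ≡ c (x + b)
  rainbow⊎sameColour {x} 1≤x x+b≤n with c x ≟ᶠ c (x + b)
  ... | yes same   = inj₂ same
  ... | no differ = inj₁ (x , (1≤x , ≤-trans (m≤m+n x b) x+b≤n) , (≤-trans 1≤x (m≤m+n x b) , x+b≤n) , differ)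

  rainbow⊎sameColourAlong : ∀ k {x} → 1 ≤ x → x + k * b ≤ n → RainbowShift b n c ⊎ c x ≡ c (x + k * b)
  rainbow⊎sameColourAlong zero    {x} _   _ = inj₂ (cong c (sym (+-identityʳ x)))
  rainbow⊎sameColourAlong (suc k) {x} 1≤x x+[b+kb]≤n
    with rainbow⊎sameColour 1≤x (≤-trans (m≤m+n (x + b) (k * b)) [x+b]+kb≤n)
       | rainbow⊎sameColourAlong k (≤-trans 1≤x (m≤m+n x b)) [x+b]+kb≤n
    where
    [x+b]+kb≤n : x + b + k * b ≤ n
    [x+b]+kb≤n = subst (_≤ n) (sym (+-assoc x b (k * b))) x+[b+kb]≤n
  ... | inj₁ rainbow | _            = inj₁ rainbow
  ... | inj₂ _       | inj₁ rainbow = inj₁ rainbow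
  ... | inj₂ same₁   | inj₂ same₂   = inj₂ (trans same₁ (trans same₂ (cong c (+-assoc x b (k * b)))))

DivCondWithin : ℕ → (ℕ → ℕ) → ℕ → Set
DivCondWithin b f n = Σ ℕ λ x → 1 ≤ x × DivCond b f x × f x ≤ n

module _ (b : ℕ) .{{_ : NonZero b}} where

  residue : ℕ → Fin b
  residue i = i mod b

  toℕ-residue : ∀ i → toℕ (residue i) ≡ i % b
  toℕ-residue i = toℕ-fromℕ< (m%n<n i b)

  residue-exact : ∀ {n} → b ≤ n → ExactColoring b n residue
  residue-exact b≤n fzero = b , (s≤s z≤n , b≤n) , toℕ-injective (trans (toℕ-residue b) (n%n≡0 b))
  residue-exact b≤n (fsuc j) = suc (toℕ j) , (s≤s z≤n , ≤-trans (<⇒≤ (toℕ<n (fsuc j))) b≤n) ,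
    toℕ-injective (trans (toℕ-residue (suc (toℕ j))) (m<n⇒m%n≡m (toℕ<n (fsuc j))))

  residue-noRainbow : ∀ {n} → ¬ RainbowShift b n residue
  residue-noRainbow (x , _ , _ , differ) =
    differ (toℕ-injective (trans (toℕ-residue x) (trans (sym ([m+n]%n≡m%n x b)) (sym (toℕ-residue (x + b))))))

  module _ {f : ℕ → ℕ} (pos : PosValued f) (inc : StrictlyIncreasing f) where

    residue-mono⇒divCondWithin : ∀ {n} → MonoSol b n f residue → DivCondWithin b f n
    residue-mono⇒divCondWithin (x , (1≤x , _) , (_ , fx≤n) , same) =
      x , 1≤x , ∣∸⇒divCond {f = f} (inflationary pos inc 1≤x) (%≡%⇒∣∸ x%b≡fx%b) , fx≤n
      where
      x%b≡fx%b : x % b ≡ f x % b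
      x%b≡fx%b = trans (sym (toℕ-residue x)) (trans (cong toℕ same) (toℕ-residue (f x)))

    grProperty⇒divCondWithin : ∀ {M n} → GRProperty b f M → M ≤ n → b ≤ n → DivCondWithin b f n
    grProperty⇒divCondWithin gr M≤n b≤n with gr _ M≤n residue (residue-exact b≤n)
    ... | inj₁ rainbow = ⊥-elim (residue-noRainbow rainbow)
    ... | inj₂ mono    = residue-mono⇒divCondWithin mono

    grProperty⇒xmin-bound : ∀ {xm M n} → IsXmin b f xm → GRProperty b f M → M ≤ n → b ≤ n → f xm ≤ n
    grProperty⇒xmin-bound (1≤xm , _ , least) gr M≤n b≤n with grProperty⇒divCondWithin gr M≤n b≤n
    ... | x , 1≤x , divCond , fx≤n = ≤-trans (monotone inc 1≤xm (least x 1≤x divCond)) fx≤n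

module _ {f : ℕ → ℕ} (pos : PosValued f) (inc : StrictlyIncreasing f) {b : ℕ} .{{_ : NonZero b}} where

  xmin-≡+* : ∀ {xm} → IsXmin b f xm → ∃ λ k → f xm ≡ xm + k * b
  xmin-≡+* {xm} (1≤xm , divCond , _) = ∣∸⇒≡+* xm≤fxm (divCond⇒∣∸ {f = f} xm≤fxm divCond)
    where
    xm≤fxm : xm ≤ f xm
    xm≤fxm = inflationary pos inc 1≤xm

  xmin-fixedPoint⊎> : ∀ {xm} → IsXmin b f xm → f xm ≡ xm ⊎ b < f xm
  xmin-fixedPoint⊎> {xm} isXmin@(1≤xm , _) with xmin-≡+* isXmin
  ... | zero  , fxm≡xm+0 = inj₁ (trans fxm≡xm+0 (+-identityʳ xm))
  ... | suc k , fxm≡xm+[b+kb] =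
    inj₂ (subst (b <_) (sym fxm≡xm+[b+kb]) (≤-trans (+-monoˡ-≤ b 1≤xm) (+-monoʳ-≤ xm (m≤m+n b (k * b)))))

  xmin-grProperty : ∀ {xm} → IsXmin b f xm → GRProperty b f (f xm)
  xmin-grProperty {xm} isXmin@(1≤xm , _) n fxm≤n c _ with xmin-≡+* isXmin
  ... | k , fxm≡xm+kb with rainbow⊎sameColourAlong c k 1≤xm (subst (_≤ n) fxm≡xm+kb fxm≤n)
  ...   | inj₁ rainbow = inj₁ rainbow
  ...   | inj₂ same    = inj₂ (xm , (1≤xm , ≤-trans (inflationary pos inc 1≤xm) fxm≤n) , (pos xm 1≤xm , fxm≤n) ,
                                trans same (cong c (sym fxm≡xm+kb)))

  -- The residue colouring is exact only on [n] with b ≤ n, so it refutes M < f(x_min)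
  -- only when b < f(x_min); otherwise f(x_min) = x_min, and fixed points of f propagate
  -- downwards, which forces x_min = 1.
  xmin-least : ∀ {xm M} → IsXmin b f xm → 1 ≤ M → GRProperty b f M → f xm ≤ M
  xmin-least {xm} {M} isXmin 1≤M gr with xmin-fixedPoint⊎> isXmin
  ... | inj₁ fxm≡xm = subst (_≤ M) (sym (trans fxm≡xm (xmin-fixedPoint⇒≡1 pos inc isXmin fxm≡xm))) 1≤M
  ... | inj₂ b<fxm with ≤-total b M
  ...   | inj₁ b≤M = grProperty⇒xmin-bound b pos inc isXmin gr ≤-refl b≤M
  ...   | inj₂ M≤b = ⊥-elim (<⇒≱ b<fxm (grProperty⇒xmin-bound b pos inc isXmin gr M≤b ≤-refl))

  xmin-isGR : ∀ {xm} → IsXmin b f xm → IsGR b f (f xm)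
  xmin-isGR isXmin@(1≤xm , _) = pos _ 1≤xm , xmin-grProperty isXmin , λ M 1≤M → xmin-least isXmin 1≤M

  ¬divCond⇒¬grExists : (∀ x → 1 ≤ x → ¬ DivCond b f x) → ¬ GRExists b f
  ¬divCond⇒¬grExists ¬divCond (M , _ , gr) with grProperty⇒divCondWithin b pos inc gr (m≤m+n M b) (m≤n+m b M)
  ... | x , 1≤x , divCond , _ = ¬divCond x 1≤x divCond

mainTheorem8 : (f : ℕ → ℕ) → PosValued f → StrictlyIncreasing f →
    (b : ℕ) → 2 ≤ b →
    ((xm : ℕ) → IsXmin b f xm → IsGR b f (f xm))
    × ((∀ x → 1 ≤ x → ¬ DivCond b f x) → ¬ GRExists b f)
mainTheorem8 f pos inc b 2≤b = (λ _ → xmin-isGR pos inc) , ¬divCond⇒¬grExists pos inc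
  where instance
    b≢0 : NonZero b
    b≢0 = >-nonZero (≤-trans (s≤s z≤n) 2≤b)
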